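{- Let $b \geq 2$ and $c$ be integers with $0 < c < 3b - 3$. Let $S_{[c,b]}:\mathbb{Z}^+\to\mathbb{Z}^+$ be defined by $S_{[c,b]}\left(\sum_{i=0}^n a_i b^i\right) = c + \sum_{i=0}^n a_i^2$ (base $b$ expansion, $0\le a_i\le b-1$, $a_n\ne0$), let $\mathcal{F}^{(1)}_{[c,b]} = \{a = ub \mid 0 < u < b \text{ and } S_{[c,b]}(a) = a\}$, and for an integer $m$ let $r_2(m) = |\{(x,y)\in\mathbb{Z}^2 \mid x^2+y^2 = m\}|$. Then the total number of fixed points of $S_{[c,b]}$ is exactly \[ \begin{cases} \tfrac{1}{2} r_2(b^2 - 4c + 1) + \left|\mathcal{F}^{(1)}_{[c,b]}\right| & \text{if } b \text{ is odd},\\[0.5em] \tfrac{1}{4} r_2(b^2 - 4c + 1) + \left|\mathcal{F}^{(1)}_{[c,b]}\right| & \text{if } b \text{ is even}.\end{cases} \]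
   Context: A fixed point of $S_{[c,b]}$ is a positive integer $a$ with $S_{[c,b]}(a)=a$. -}

module Defs where

open import Data.Nat using (ℕ; zero; suc; _+_; _*_; _∸_; _≤_; _<_; NonZero)
open import Data.Nat.DivMod using (_/_; _%_)
open import Data.Integer as ℤ using (ℤ; +_; ∣_∣)
open import Data.List using (List; []; _∷_; map; upTo; length; filter; cartesianProduct)
open import Data.Product using (_×_; _,_; proj₁; proj₂)
open import Relation.Nullary using (Dec; yes; no)
import Data.Nat as ℕ

-- Sum of squares of the base-b digits of a, computed with fuel.
-- With fuel ≥ number of digits (fuel = a suffices) this is Σ a_i².
digitSqSumFuel : (b : ℕ) .{{_ : NonZero b}} → ℕ → ℕ → ℕ
digitSqSumFuel b zero    a = 0
digitSqSumFuel b (suc k) zero = 0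
digitSqSumFuel b (suc k) a@(suc _) = (a % b) * (a % b) + digitSqSumFuel b k (a / b)

digitSqSum : (b : ℕ) .{{_ : NonZero b}} → ℕ → ℕ
digitSqSum b a = digitSqSumFuel b a a

S : (c b : ℕ) .{{_ : NonZero b}} → ℕ → ℕ
S c b a = c + digitSqSum b a

IsFixedPoint : (c b : ℕ) .{{_ : NonZero b}} → ℕ → Set
IsFixedPoint c b a = (0 < a) × (S c b a ≡ a)
  where open import Relation.Binary.PropositionalEquality using (_≡_)

F1card : (c b : ℕ) .{{_ : NonZero b}} → ℕ
F1card c b = length (filter (λ u → S c b (u * b) ℕ.≟ u * b) (map suc (upTo (b ∸ 1))))

intRange : ℕ → List ℤ
intRange k = map (λ i → (+ i) ℤ.- (+ k)) (upTo (suc (k + k)))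

-- r₂(m) = #{(x,y) ∈ ℤ² : x² + y² = m}; any solution has |x|,|y| ≤ |m|,
-- so it suffices to enumerate [-|m|,|m|]².
r₂ : ℤ → ℕ
r₂ m = length (filter (λ p → (proj₁ p ℤ.* proj₁ p ℤ.+ proj₂ p ℤ.* proj₂ p) ℤ.≟ m)
                      (cartesianProduct (intRange ∣ m ∣) (intRange ∣ m ∣)))

-- A fixed point a < b² is a two-digit number a₁ b + a₀, and completing squares turns S(a) = a into
-- x² + y² = b² − 4c + 1 with x = 2a₁ − b and y = 2a₀ − 1; when c < 3b − 3 the digit-square sum of any
-- a ≥ b² is too small for a to be fixed. Modulo 4 the circle equation forces x and y to be both odd when
-- b is odd, and of opposite parity when b is even. The fixed points with a₀ = 0 (y = −1) are those
-- counted by F⁽¹⁾; the others are exactly the lattice points with y > 0 and x ≡ b (mod 2), and folding ℤ²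
-- along x ↦ −x and y ↦ −y shows that these make up half of all r₂ points when b is odd and a quarter
-- when b is even.
module Submission where

open import Defs
open import Data.Bool.Base using (if_then_else_)
open import Data.Integer as ℤ using (ℤ)
import Data.Integer.Properties as ℤ
import Data.Integer.Tactic.RingSolver as ℤ-Solver
open import Data.List using (List; _++_; map; length; filter; applyUpTo; upTo; cartesianProduct)
open import Data.List.Properties using (length-++; filter-++; map-applyUpTo; map-upTo)
open import Data.List.Membership.Propositional using (_∈_)
open import Data.List.Membership.Propositional.Properties using (∈-filter⁺; ∈-filter⁻; ∈-upTo⁺)
open import Data.List.Relation.Unary.Unique.Propositional using (Unique)
open import Data.List.Relation.Unary.Unique.Propositional.Properties using (filter⁺; upTo⁺)
open import Data.Nat
open import Data.Nat.DivMod
open import Data.Nat.Induction using (<-rec)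
open import Data.Nat.Properties
open import Data.Nat.Tactic.RingSolver using (solve-∀)
import Algebra.Properties.CommutativeSemigroup +-commutativeSemigroup as +-CS
import Algebra.Properties.CommutativeSemigroup *-commutativeSemigroup as *-CS
open import Data.Product using (Σ; _×_; _,_; proj₁; proj₂)
open import Data.Sum using (_⊎_; inj₁; inj₂)
open import Function.Base using (_∘_)
open import Function.Bundles using (_⇔_; mk⇔; Equivalence)
open import Relation.Binary.PropositionalEquality
open import Relation.Nullary using (Dec; yes; no; ¬_; does; contradiction; _×-dec_)
open import Relation.Nullary.Decidable using (dec-false; does-⇔)
open import Relation.Unary using (Pred; Decidable)

-- Finite sums

sumBelow : ℕ → (ℕ → ℕ) → ℕ
sumBelow zero    f = 0
sumBelow (suc n) f = f 0 + sumBelow n (λ i → f (suc i))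

syntax sumBelow n (λ i → e) = ∑[ i < n ] e

module _ where
  open ≡-Reasoning

  sum-cong : ∀ n {f g : ℕ → ℕ} → (∀ i → i < n → f i ≡ g i) → sumBelow n f ≡ sumBelow n g
  sum-cong zero    eq = refl
  sum-cong (suc n) eq = cong₂ _+_ (eq 0 z<s) (sum-cong n (λ i i<n → eq (suc i) (s<s i<n)))

  sum-zero : ∀ n {f : ℕ → ℕ} → (∀ i → i < n → f i ≡ 0) → sumBelow n f ≡ 0
  sum-zero n eq = trans (sum-cong n eq) (lemma n)
    where lemma : ∀ n → sumBelow n (λ _ → 0) ≡ 0
          lemma zero    = refl
          lemma (suc n) = lemma n

  sum-+ : ∀ n (f g : ℕ → ℕ) → ∑[ i < n ] (f i + g i) ≡ sumBelow n f + sumBelow n g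
  sum-+ zero    f g = refl
  sum-+ (suc n) f g = begin
    f 0 + g 0 + ∑[ i < n ] (f (suc i) + g (suc i))   ≡⟨ cong (f 0 + g 0 +_) (sum-+ n _ _) ⟩
    f 0 + g 0 + (∑[ i < n ] f (suc i) + ∑[ i < n ] g (suc i)) ≡⟨ +-CS.interchange (f 0) (g 0) _ _ ⟩
    f 0 + ∑[ i < n ] f (suc i) + (g 0 + ∑[ i < n ] g (suc i)) ∎

  *-distribˡ-sum : ∀ n k (f : ℕ → ℕ) → ∑[ i < n ] (k * f i) ≡ k * sumBelow n f
  *-distribˡ-sum zero    k f = sym (*-zeroʳ k)
  *-distribˡ-sum (suc n) k f =
    trans (cong (k * f 0 +_) (*-distribˡ-sum n k _)) (sym (*-distribˡ-+ k (f 0) _))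

  sum-split : ∀ m n (f : ℕ → ℕ) → sumBelow (m + n) f ≡ sumBelow m f + ∑[ i < n ] f (m + i)
  sum-split zero    n f = refl
  sum-split (suc m) n f = trans (cong (f 0 +_) (sum-split m n _)) (sym (+-assoc (f 0) _ _))

  sum-truncate : ∀ {m n} (f : ℕ → ℕ) → m ≤ n → (∀ i → m ≤ i → f i ≡ 0) → sumBelow n f ≡ sumBelow m f
  sum-truncate {m} f m≤n vanish with k , refl ← m≤n⇒∃[o]m+o≡n m≤n = begin
    sumBelow (m + k) f                     ≡⟨ sum-split m k f ⟩
    sumBelow m f + ∑[ i < k ] f (m + i)    ≡⟨ cong (sumBelow m f +_) (sum-zero k (λ i _ → vanish (m + i) (m≤m+n m i))) ⟩
    sumBelow m f + 0                       ≡⟨ +-identityʳ _ ⟩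
    sumBelow m f                           ∎

  sum-reverse : ∀ n (f : ℕ → ℕ) → sumBelow n f ≡ ∑[ i < n ] f (n ∸ suc i)
  sum-reverse zero    f = refl
  sum-reverse (suc n) f = begin
    f 0 + ∑[ i < n ] f (suc i)                         ≡⟨ cong (f 0 +_) (sum-reverse n _) ⟩
    f 0 + ∑[ i < n ] f (suc (n ∸ suc i))              ≡⟨ +-comm (f 0) _ ⟩
    ∑[ i < n ] f (suc (n ∸ suc i)) + f 0              ≡⟨ cong₂ _+_ (sum-cong n (λ i i<n → cong f (sym (+-∸-assoc 1 i<n))))
                                                                  (cong f (sym (n∸n≡0 n))) ⟩
    ∑[ i < n ] f (suc n ∸ suc i) + f (suc n ∸ suc n) ≡⟨ sym (sum-last n) ⟩
    ∑[ i < suc n ] f (suc n ∸ suc i)                  ∎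
    where
    sum-last : ∀ n {g : ℕ → ℕ} → sumBelow (suc n) g ≡ sumBelow n g + g n
    sum-last n {g} = begin
      sumBelow (suc n) g                  ≡⟨ cong (λ m → sumBelow m g) (+-comm 1 n) ⟩
      sumBelow (n + 1) g                  ≡⟨ sum-split n 1 g ⟩
      sumBelow n g + (g (n + 0) + 0)      ≡⟨ cong (sumBelow n g +_) (trans (+-identityʳ _) (cong g (+-identityʳ n))) ⟩
      sumBelow n g + g n                  ∎

  sum-halves : ∀ n (f : ℕ → ℕ) → sumBelow (n + n) f ≡ ∑[ i < n ] f (n ∸ suc i) + ∑[ i < n ] f (n + i)
  sum-halves n f = trans (sum-split n n f) (cong (_+ ∑[ i < n ] f (n + i)) (sum-reverse n f))

  sum-comm : ∀ m n (f : ℕ → ℕ → ℕ) → ∑[ i < m ] ∑[ j < n ] f i j ≡ ∑[ j < n ] ∑[ i < m ] f i j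
  sum-comm zero    n f = sym (sum-zero n (λ _ _ → refl))
  sum-comm (suc m) n f = trans (cong (sumBelow n (f 0) +_) (sum-comm m n (λ i → f (suc i))))
                               (sym (sum-+ n (f 0) _))

  sum-evens-odds : ∀ n (f : ℕ → ℕ) → sumBelow (n + n) f ≡ ∑[ i < n ] f (2 * i) + ∑[ i < n ] f (suc (2 * i))
  sum-evens-odds zero    f = refl
  sum-evens-odds (suc n) f = begin
    f 0 + sumBelow (n + suc n) (λ i → f (suc i))
      ≡⟨ cong (λ m → f 0 + sumBelow m (λ i → f (suc i))) (+-suc n n) ⟩
    f 0 + (f 1 + sumBelow (n + n) (λ i → f (2 + i)))
      ≡⟨ cong (λ x → f 0 + (f 1 + x)) (sum-evens-odds n (λ i → f (2 + i))) ⟩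
    f 0 + (f 1 + (∑[ i < n ] f (2 + 2 * i) + ∑[ i < n ] f (3 + 2 * i)))
      ≡⟨ regroup (f 0) (f 1) _ _ ⟩
    f 0 + ∑[ i < n ] f (2 + 2 * i) + (f 1 + ∑[ i < n ] f (3 + 2 * i))
      ≡⟨ cong₂ (λ x y → f 0 + x + (f 1 + y)) (sum-cong n (λ i _ → cong f (double-suc i)))
                                                (sum-cong n (λ i _ → cong (λ x → f (suc x)) (double-suc i))) ⟩
    f 0 + ∑[ i < n ] f (2 * suc i) + (f 1 + ∑[ i < n ] f (suc (2 * suc i))) ∎
    where regroup : ∀ a b c d → a + (b + (c + d)) ≡ a + c + (b + d)
          regroup = solve-∀
          double-suc : ∀ i → 2 + 2 * i ≡ 2 * suc i
          double-suc = solve-∀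

  sum²-truncate : ∀ {m n} (f : ℕ → ℕ → ℕ) → m ≤ n → (∀ i j → m ≤ i → f i j ≡ 0) → (∀ i j → m ≤ j → f i j ≡ 0) →
                  ∑[ i < n ] ∑[ j < n ] f i j ≡ ∑[ i < m ] ∑[ j < m ] f i j
  sum²-truncate {m} {n} f m≤n vanishˡ vanishʳ = begin
    ∑[ i < n ] ∑[ j < n ] f i j ≡⟨ sum-truncate _ m≤n (λ i m≤i → sum-zero n (λ j _ → vanishˡ i j m≤i)) ⟩
    ∑[ i < m ] ∑[ j < n ] f i j ≡⟨ sum-cong m (λ i _ → sum-truncate (f i) m≤n (λ j m≤j → vanishʳ i j m≤j)) ⟩
    ∑[ i < m ] ∑[ j < m ] f i j ∎

  sum²-evens-odds : ∀ n (f : ℕ → ℕ → ℕ) → ∑[ i < n + n ] ∑[ j < n + n ] f i j ≡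
    (∑[ i < n ] ∑[ j < n ] f (2 * i) (2 * j) + ∑[ i < n ] ∑[ j < n ] f (2 * i) (suc (2 * j)))
    + (∑[ i < n ] ∑[ j < n ] f (suc (2 * i)) (2 * j) + ∑[ i < n ] ∑[ j < n ] f (suc (2 * i)) (suc (2 * j)))
  sum²-evens-odds n f = trans (sum-evens-odds n (λ i → sumBelow (n + n) (f i)))
    (cong₂ _+_ (inner (λ i → 2 * i)) (inner (λ i → suc (2 * i))))
    where inner : ∀ (row : ℕ → ℕ) → ∑[ i < n ] sumBelow (n + n) (f (row i))
                                    ≡ ∑[ i < n ] ∑[ j < n ] f (row i) (2 * j) + ∑[ i < n ] ∑[ j < n ] f (row i) (suc (2 * j))
          inner row = trans (sum-cong n (λ i _ → sum-evens-odds n (f (row i)))) (sum-+ n _ _)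

  sum-blocks : ∀ m n (f : ℕ → ℕ) → sumBelow (m * n) f ≡ ∑[ q < m ] ∑[ r < n ] f (q * n + r)
  sum-blocks zero    n f = refl
  sum-blocks (suc m) n f = trans (sum-split n (m * n) f) (cong (sumBelow n f +_) (begin
    ∑[ i < m * n ] f (n + i)                  ≡⟨ sum-blocks m n (λ i → f (n + i)) ⟩
    ∑[ q < m ] ∑[ r < n ] f (n + (q * n + r)) ≡⟨ sum-cong m (λ q _ → sum-cong n (λ r _ → cong f (sym (+-assoc n (q * n) r)))) ⟩
    ∑[ q < m ] ∑[ r < n ] f (n + q * n + r)   ∎))

𝟙 : ∀ {p} {P : Set p} → Dec P → ℕ
𝟙 P? = if does P? then 1 else 0

𝟙-⇔ : ∀ {p q} {P : Set p} {Q : Set q} → P ⇔ Q → (P? : Dec P) (Q? : Dec Q) → 𝟙 P? ≡ 𝟙 Q?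
𝟙-⇔ P⇔Q P? Q? = cong (λ b → if b then 1 else 0) (does-⇔ P⇔Q P? Q?)

𝟙-¬ : ∀ {p} {P : Set p} → ¬ P → (P? : Dec P) → 𝟙 P? ≡ 0
𝟙-¬ ¬p P? = cong (λ b → if b then 1 else 0) (dec-false P? ¬p)

module _ {a p} {A : Set a} {P : Pred A p} (P? : Decidable P) where

  length-filter-applyUpTo : ∀ n (g : ℕ → A) → length (filter P? (applyUpTo g n)) ≡ ∑[ i < n ] 𝟙 (P? (g i))
  length-filter-applyUpTo zero    g = refl
  length-filter-applyUpTo (suc n) g with P? (g 0)
  ... | yes _ = cong suc (length-filter-applyUpTo n (λ i → g (suc i)))
  ... | no _  = length-filter-applyUpTo n (λ i → g (suc i))

module _ {a b p} {A : Set a} {B : Set b} {P : Pred (A × B) p} (P? : Decidable P) where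
  open ≡-Reasoning

  length-filter-cartesianProduct : ∀ m n (g : ℕ → A) (h : ℕ → B) →
    length (filter P? (cartesianProduct (applyUpTo g m) (applyUpTo h n))) ≡ ∑[ i < m ] ∑[ j < n ] 𝟙 (P? (g i , h j))
  length-filter-cartesianProduct zero    n g h = refl
  length-filter-cartesianProduct (suc m) n g h = begin
    length (filter P? (map (g 0 ,_) hs ++ rest))
      ≡⟨ cong length (filter-++ P? (map (g 0 ,_) hs) rest) ⟩
    length (filter P? (map (g 0 ,_) hs) ++ filter P? rest)
      ≡⟨ length-++ (filter P? (map (g 0 ,_) hs)) ⟩
    length (filter P? (map (g 0 ,_) hs)) + length (filter P? rest)
      ≡⟨ cong₂ _+_ (trans (cong (length ∘ filter P?) (map-applyUpTo h (g 0 ,_) n)) (length-filter-applyUpTo P? n (λ j → g 0 , h j)))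
                   (length-filter-cartesianProduct m n (λ i → g (suc i)) h) ⟩
    ∑[ i < suc m ] ∑[ j < n ] 𝟙 (P? (g i , h j)) ∎
    where hs   = applyUpTo h n
          rest = cartesianProduct (applyUpTo (λ i → g (suc i)) m) hs

-- Folding sums over symmetric ranges

weight : ℕ → ℕ
weight zero    = 1
weight (suc _) = 2

weight-double : ∀ n → weight (2 * n) ≡ weight n
weight-double zero    = refl
weight-double (suc n) = refl

∣m+n-m∣≡n : ∀ m n → ∣ m + n - m ∣ ≡ n
∣m+n-m∣≡n m n = trans (∣-∣-comm (m + n) m) (∣m-m+n∣≡n m n)

∣m+n-n∣≡m : ∀ m n → ∣ m + n - n ∣ ≡ m
∣m+n-n∣≡m m n = trans (cong (∣_- n ∣) (+-comm m n)) (∣m+n-m∣≡n n m)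

sum-fold : ∀ k (h : ℕ → ℕ) → ∑[ i < suc (k + k) ] h ∣ i - k ∣ ≡ ∑[ u < suc k ] (weight u * h u)
sum-fold k h = begin
  sumBelow (suc (k + k)) f
    ≡⟨ cong (λ n → sumBelow n f) (+-suc k k) ⟨
  sumBelow (k + suc k) f
    ≡⟨ sum-split k (suc k) f ⟩
  sumBelow k f + ∑[ i < suc k ] f (k + i)
    ≡⟨ cong (_+ ∑[ i < suc k ] f (k + i)) (sum-reverse k f) ⟩
  ∑[ i < k ] f (k ∸ suc i) + ∑[ i < suc k ] f (k + i)
    ≡⟨ cong₂ _+_ (sum-cong k left) (sum-cong (suc k) (λ i _ → cong h (∣m+n-m∣≡n k i))) ⟩
  ∑[ i < k ] h (suc i) + (h 0 + ∑[ i < k ] h (suc i))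
    ≡⟨ regroup (h 0) (∑[ i < k ] h (suc i)) ⟩
  1 * h 0 + 2 * ∑[ i < k ] h (suc i)
    ≡⟨ cong (1 * h 0 +_) (*-distribˡ-sum k 2 (λ i → h (suc i))) ⟨
  ∑[ u < suc k ] (weight u * h u)
    ∎
  where
  open ≡-Reasoning
  f = λ i → h ∣ i - k ∣
  left : ∀ i → i < k → f (k ∸ suc i) ≡ h (suc i)
  left i i<k with e , refl ← m≤n⇒∃[o]m+o≡n i<k =
    cong h (trans (cong (∣_- suc i + e ∣) (m+n∸m≡n (suc i) e)) (trans (∣-∣-comm e (suc i + e)) (∣m+n-n∣≡m (suc i) e)))
  regroup : ∀ a x → x + (a + x) ≡ 1 * a + 2 * x
  regroup = solve-∀

sum-fold-odd : ∀ t (g : ℕ → ℕ) →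
  ∑[ a < suc (2 * t) ] g ∣ 2 * a - suc (2 * t) ∣ ≡ g (suc (2 * t)) + 2 * ∑[ i < t ] g (suc (2 * i))
sum-fold-odd t g = cong (g (suc (2 * t)) +_) (begin
  sumBelow (2 * t) f                                 ≡⟨ cong (λ n → sumBelow n f) (cong (t +_) (+-identityʳ t)) ⟩
  sumBelow (t + t) f                                 ≡⟨ sum-halves t f ⟩
  ∑[ i < t ] f (t ∸ suc i) + ∑[ i < t ] f (t + i)    ≡⟨ cong₂ _+_ (sum-cong t left) (sum-cong t right) ⟩
  ∑[ i < t ] g (suc (2 * i)) + ∑[ i < t ] g (suc (2 * i)) ≡⟨ cong (sumBelow t (λ i → g (suc (2 * i))) +_) (+-identityʳ _) ⟨
  2 * ∑[ i < t ] g (suc (2 * i))                     ∎)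
  where
  open ≡-Reasoning
  f = λ a → g ∣ 2 * suc a - suc (2 * t) ∣
  left : ∀ i → i < t → f (t ∸ suc i) ≡ g (suc (2 * i))
  left i i<t with e , refl ← m≤n⇒∃[o]m+o≡n i<t = cong g (begin
    ∣ 2 * suc (suc i + e ∸ suc i) - suc (2 * (suc i + e)) ∣
      ≡⟨ cong (λ x → ∣ 2 * suc x - suc (2 * (suc i + e)) ∣) (m+n∸m≡n (suc i) e) ⟩
    ∣ 2 * suc e - suc (2 * (suc i + e)) ∣
      ≡⟨ cong (∣ 2 * suc e -_∣) (identity e i) ⟩
    ∣ 2 * suc e - 2 * suc e + suc (2 * i) ∣
      ≡⟨ ∣m-m+n∣≡n (2 * suc e) (suc (2 * i)) ⟩
    suc (2 * i)
      ∎)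
    where identity : ∀ e i → suc (2 * (suc i + e)) ≡ 2 * suc e + suc (2 * i)
          identity = solve-∀
  right : ∀ i → i < t → f (t + i) ≡ g (suc (2 * i))
  right i _ = cong g (trans (cong (∣_- suc (2 * t) ∣) (identity t i)) (∣m+n-n∣≡m (suc (2 * i)) (suc (2 * t))))
    where identity : ∀ t i → 2 * suc (t + i) ≡ suc (2 * i) + suc (2 * t)
          identity = solve-∀

-- The circle equation

∣m-n∣*∣m-n∣+2*m*n : ∀ m n → ∣ m - n ∣ * ∣ m - n ∣ + 2 * m * n ≡ m * m + n * n
∣m-n∣*∣m-n∣+2*m*n m n with ≤-total m n
... | inj₁ m≤n with d , refl ← m≤n⇒∃[o]m+o≡n m≤n =
  trans (cong (λ x → x * x + 2 * m * (m + d)) (∣m-m+n∣≡n m d)) (identity m d)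
  where identity : ∀ m d → d * d + 2 * m * (m + d) ≡ m * m + (m + d) * (m + d)
        identity = solve-∀
... | inj₂ n≤m with d , refl ← m≤n⇒∃[o]m+o≡n n≤m =
  trans (cong (λ x → x * x + 2 * (n + d) * n) (trans (∣-∣-comm (n + d) n) (∣m-m+n∣≡n n d))) (identity n d)
  where identity : ∀ n d → d * d + 2 * (n + d) * n ≡ (n + d) * (n + d) + n * n
        identity = solve-∀

OnCircle : (c b u v : ℕ) → Set
OnCircle c b u v = 4 * c + u * u + v * v ≡ b * b + 1

completing-squares : ∀ c b a₁ a₀ →
  let X = ∣ 2 * a₁ - b ∣ ; Y = ∣ 2 * a₀ - 1 ∣ in
  4 * c + X * X + Y * Y + 4 * (a₁ * b + a₀) ≡ 4 * (c + (a₀ * a₀ + a₁ * a₁)) + (b * b + 1)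
completing-squares c b a₁ a₀ = begin
  4 * c + X * X + Y * Y + 4 * (a₁ * b + a₀)
    ≡⟨ regroup₁ c (X * X) (Y * Y) a₁ b a₀ ⟩
  4 * c + (X * X + 2 * (2 * a₁) * b) + (Y * Y + 2 * (2 * a₀) * 1)
    ≡⟨ cong₂ (λ x y → 4 * c + x + y) (∣m-n∣*∣m-n∣+2*m*n (2 * a₁) b) (∣m-n∣*∣m-n∣+2*m*n (2 * a₀) 1) ⟩
  4 * c + (2 * a₁ * (2 * a₁) + b * b) + (2 * a₀ * (2 * a₀) + 1 * 1)
    ≡⟨ regroup₂ c a₁ b a₀ ⟩
  4 * (c + (a₀ * a₀ + a₁ * a₁)) + (b * b + 1) ∎
  where
  open ≡-Reasoning
  X = ∣ 2 * a₁ - b ∣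
  Y = ∣ 2 * a₀ - 1 ∣
  regroup₁ : ∀ c x y a₁ b a₀ → 4 * c + x + y + 4 * (a₁ * b + a₀)
                               ≡ 4 * c + (x + 2 * (2 * a₁) * b) + (y + 2 * (2 * a₀) * 1)
  regroup₁ = solve-∀
  regroup₂ : ∀ c a₁ b a₀ → 4 * c + (2 * a₁ * (2 * a₁) + b * b) + (2 * a₀ * (2 * a₀) + 1 * 1)
                           ≡ 4 * (c + (a₀ * a₀ + a₁ * a₁)) + (b * b + 1)
  regroup₂ = solve-∀

digitEquation⇔onCircle : ∀ c b a₁ a₀ →
  (c + (a₀ * a₀ + a₁ * a₁) ≡ a₁ * b + a₀) ⇔ OnCircle c b ∣ 2 * a₁ - b ∣ ∣ 2 * a₀ - 1 ∣
digitEquation⇔onCircle c b a₁ a₀ = mk⇔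
  (λ eq → +-cancelʳ-≡ _ _ _ (trans (completing-squares c b a₁ a₀)
                               (trans (cong (λ e → 4 * e + (b * b + 1)) eq) (+-comm _ (b * b + 1)))))
  (λ eq → *-cancelˡ-≡ _ _ 4 (+-cancelʳ-≡ (b * b + 1) _ _ (trans (sym (completing-squares c b a₁ a₀))
                               (trans (cong (_+ 4 * (a₁ * b + a₀)) eq) (+-comm (b * b + 1) _)))))

square≡4*q+parity : ∀ n → Σ ℕ (λ q → n * n ≡ 4 * q + n % 2)
square≡4*q+parity zero          = 0 , refl
square≡4*q+parity (suc zero)    = 0 , refl
square≡4*q+parity (suc (suc n)) with q , eq ← square≡4*q+parity n = q + n + 1 , (begin
  suc (suc n) * suc (suc n)     ≡⟨ expand n ⟩
  n * n + 4 * (n + 1)           ≡⟨ cong (_+ 4 * (n + 1)) eq ⟩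
  4 * q + n % 2 + 4 * (n + 1)   ≡⟨ regroup q (n % 2) n ⟩
  4 * (q + n + 1) + n % 2       ≡⟨ cong (4 * (q + n + 1) +_) ([m+kn]%n≡m%n n 1 2) ⟨
  4 * (q + n + 1) + (n + 1 * 2) % 2 ≡⟨ cong (λ m → 4 * (q + n + 1) + m % 2) (+-comm n 2) ⟩
  4 * (q + n + 1) + suc (suc n) % 2 ∎)
  where
  open ≡-Reasoning
  expand : ∀ n → suc (suc n) * suc (suc n) ≡ n * n + 4 * (n + 1)
  expand = solve-∀
  regroup : ∀ q r n → 4 * q + r + 4 * (n + 1) ≡ 4 * (q + n + 1) + r
  regroup = solve-∀

4*q+r≡4*p+s⇒r≡s : ∀ q p {r s} → r < 4 → s < 4 → 4 * q + r ≡ 4 * p + s → r ≡ s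
4*q+r≡4*p+s⇒r≡s q p {r} {s} r<4 s<4 eq = begin
  r               ≡⟨ remainder q r<4 ⟨
  (4 * q + r) % 4 ≡⟨ cong (_% 4) eq ⟩
  (4 * p + s) % 4 ≡⟨ remainder p s<4 ⟩
  s               ∎
  where
  open ≡-Reasoning
  remainder : ∀ q {r} → r < 4 → (4 * q + r) % 4 ≡ r
  remainder q {r} r<4 = trans (cong (_% 4) (trans (+-comm (4 * q) r) (cong (r +_) (*-comm 4 q))))
                              (trans ([m+kn]%n≡m%n r q 4) (m<n⇒m%n≡m r<4))

[2*n]%2≡0 : ∀ n → 2 * n % 2 ≡ 0
[2*n]%2≡0 n = trans (cong (_% 2) (*-comm 2 n)) (m*n%n≡0 n 2)

[1+2*n]%2≡1 : ∀ n → suc (2 * n) % 2 ≡ 1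
[1+2*n]%2≡1 n = trans (cong (λ x → suc x % 2) (*-comm 2 n)) ([m+kn]%n≡m%n 1 n 2)

onCircle-parity : ∀ {c b u v} → OnCircle c b u v → u % 2 + v % 2 ≡ b % 2 + 1
onCircle-parity {c} {b} {u} {v} eq
  with p , u² ← square≡4*q+parity u | q , v² ← square≡4*q+parity v | r , b² ← square≡4*q+parity b =
  4*q+r≡4*p+s⇒r≡s (c + p + q) r (+-mono-< (m%n<n u 2) (m%n<n v 2)) (+-monoˡ-< 1 (m<n⇒m<1+n (m%n<n b 2)))
    (begin
      4 * (c + p + q) + (u % 2 + v % 2)         ≡⟨ regroup₁ c p q (u % 2) (v % 2) ⟩
      4 * c + (4 * p + u % 2) + (4 * q + v % 2) ≡⟨ cong₂ (λ x y → 4 * c + x + y) u² v² ⟨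
      4 * c + u * u + v * v                     ≡⟨ eq ⟩
      b * b + 1                                 ≡⟨ cong (_+ 1) b² ⟩
      4 * r + b % 2 + 1                         ≡⟨ +-assoc (4 * r) (b % 2) 1 ⟩
      4 * r + (b % 2 + 1)                       ∎)
  where
  open ≡-Reasoning
  regroup₁ : ∀ c p q x y → 4 * (c + p + q) + (x + y) ≡ 4 * c + (4 * p + x) + (4 * q + y)
  regroup₁ = solve-∀

∣+m-+n∣≡∣m-n∣ : ∀ m n → ℤ.∣ ℤ.+ m ℤ.- ℤ.+ n ∣ ≡ ∣ m - n ∣
∣+m-+n∣≡∣m-n∣ m n with ≤-total m n
... | inj₁ m≤n = trans (cong ℤ.∣_∣ (ℤ.[+m]-[+n]≡m⊖n m n)) (trans (ℤ.∣⊖∣-≤ m≤n) (sym (m≤n⇒∣m-n∣≡n∸m m≤n)))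
... | inj₂ n≤m = trans (cong ℤ.∣_∣ (trans (ℤ.[+m]-[+n]≡m⊖n m n) (ℤ.⊖-≥ n≤m))) (sym (m≤n⇒∣n-m∣≡n∸m n≤m))

i*i≡+∣i∣*∣i∣ : ∀ i → i ℤ.* i ≡ ℤ.+ (ℤ.∣ i ∣ * ℤ.∣ i ∣)
i*i≡+∣i∣*∣i∣ (ℤ.+ n)    = sym (ℤ.pos-* n n)
i*i≡+∣i∣*∣i∣ ℤ.-[1+ n ] = refl

[+u]≡[+p]-[+q]+1⇔q+u≡p+1 : ∀ p q u → (ℤ.+ u ≡ ℤ.+ p ℤ.- ℤ.+ q ℤ.+ ℤ.+ 1) ⇔ (q + u ≡ p + 1)
[+u]≡[+p]-[+q]+1⇔q+u≡p+1 p q u = mk⇔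
  (λ eq → ℤ.+-injective (begin
    ℤ.+ (q + u)                             ≡⟨ ℤ.pos-+ q u ⟩
    ℤ.+ q ℤ.+ ℤ.+ u                         ≡⟨ cong (ℤ._+_ (ℤ.+ q)) eq ⟩
    ℤ.+ q ℤ.+ (ℤ.+ p ℤ.- ℤ.+ q ℤ.+ ℤ.+ 1)   ≡⟨ cancel (ℤ.+ q) (ℤ.+ p) ⟩
    ℤ.+ p ℤ.+ ℤ.+ 1                         ≡⟨ ℤ.pos-+ p 1 ⟨
    ℤ.+ (p + 1)                             ∎))
  (λ eq → begin
    ℤ.+ u                                   ≡⟨ uncancel (ℤ.+ q) (ℤ.+ u) ⟩
    ℤ.+ q ℤ.+ ℤ.+ u ℤ.- ℤ.+ q               ≡⟨ cong (ℤ._- ℤ.+ q) (trans (sym (ℤ.pos-+ q u)) (trans (cong ℤ.+_ eq) (ℤ.pos-+ p 1)))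
                                             ⟩
    ℤ.+ p ℤ.+ ℤ.+ 1 ℤ.- ℤ.+ q               ≡⟨ reorder (ℤ.+ q) (ℤ.+ p) ⟩
    ℤ.+ p ℤ.- ℤ.+ q ℤ.+ ℤ.+ 1               ∎)
  where
  open ≡-Reasoning
  cancel : ∀ (q p : ℤ) → q ℤ.+ (p ℤ.- q ℤ.+ ℤ.+ 1) ≡ p ℤ.+ ℤ.+ 1
  cancel = ℤ-Solver.solve-∀
  uncancel : ∀ (q u : ℤ) → u ≡ q ℤ.+ u ℤ.- q
  uncancel = ℤ-Solver.solve-∀
  reorder : ∀ (q p : ℤ) → p ℤ.+ ℤ.+ 1 ℤ.- q ≡ p ℤ.- q ℤ.+ ℤ.+ 1
  reorder = ℤ-Solver.solve-∀

-- Base-b digits and the absence of large fixed points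

m+o≡n⇒m≤n : ∀ {m n} o → m + o ≡ n → m ≤ n
m+o≡n⇒m≤n {m} o refl = m≤m+n m o

m*m+n*n≤m*[n*n]+1 : ∀ {m n} → 0 < m → m < n → m * m + n * n ≤ m * (n * n) + 1
m*m+n*n≤m*[n*n]+1 {suc s} (s≤s _) m<n with e , refl ← m≤n⇒∃[o]m+o≡n m<n =
  m+o≡n⇒m≤n _ (identity s e)
  where
  identity : ∀ s e → suc s * suc s + (2 + s + e) * (2 + s + e) + s * (s * s + 3 * s + 2 + 2 * s * e + 4 * e + e * e)
                   ≡ suc s * ((2 + s + e) * (2 + s + e)) + 1
  identity = solve-∀

3*n+m*m≤n*n+m+2 : ∀ {m n} → m < n → 3 * n + m * m ≤ n * n + m + 2
3*n+m*m≤n*n+m+2 {m} m<n with m≤n⇒∃[o]m+o≡n m<n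
... | zero  , refl = m+o≡n⇒m≤n _ (identity m)
  where identity : ∀ m → 3 * (suc m + 0) + m * m + 0 ≡ (suc m + 0) * (suc m + 0) + m + 2
        identity = solve-∀
... | suc g , refl = m+o≡n⇒m≤n _ (identity m g)
  where identity : ∀ m g → 3 * (suc m + suc g) + m * m + (2 * m + g * g + 2 * m * g + g)
                           ≡ (suc m + suc g) * (suc m + suc g) + m + 2
        identity = solve-∀

module Digits {b : ℕ} .{{_ : NonZero b}} (1<b : 1 < b) where

  /-decreasing : ∀ n → suc n / b ≤ n
  /-decreasing n = <⇒≤pred (m/n<m (suc n) b 1<b)

  digitSqSumFuel-irrelevant : ∀ k l a → a ≤ k → a ≤ l → digitSqSumFuel b k a ≡ digitSqSumFuel b l a
  digitSqSumFuel-irrelevant zero    zero    zero    _ _ = refl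
  digitSqSumFuel-irrelevant zero    (suc l) zero    _ _ = refl
  digitSqSumFuel-irrelevant (suc k) zero    zero    _ _ = refl
  digitSqSumFuel-irrelevant (suc k) (suc l) zero    _ _ = refl
  digitSqSumFuel-irrelevant (suc k) (suc l) (suc n) (s≤s n≤k) (s≤s n≤l) =
    cong (suc n % b * (suc n % b) +_)
      (digitSqSumFuel-irrelevant k l (suc n / b) (≤-trans (/-decreasing n) n≤k) (≤-trans (/-decreasing n) n≤l))

  digitSqSum-step : ∀ a → digitSqSum b a ≡ a % b * (a % b) + digitSqSum b (a / b)
  digitSqSum-step zero    = sym (cong₂ (λ r q → r * r + digitSqSum b q) (m<n⇒m%n≡m (<-trans z<s 1<b)) (0/n≡0 b))
  digitSqSum-step (suc n) = cong (suc n % b * (suc n % b) +_)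
    (digitSqSumFuel-irrelevant n (suc n / b) (suc n / b) (/-decreasing n) ≤-refl)

  %-digit : ∀ q {r} → r < b → (q * b + r) % b ≡ r
  %-digit q {r} r<b = begin
    (q * b + r) % b ≡⟨ cong (_% b) (+-comm (q * b) r) ⟩
    (r + q * b) % b ≡⟨ [m+kn]%n≡m%n r q b ⟩
    r % b           ≡⟨ m<n⇒m%n≡m r<b ⟩
    r               ∎
    where open ≡-Reasoning

  /-digit : ∀ q {r} → r < b → (q * b + r) / b ≡ q
  /-digit q {r} r<b = begin
    (q * b + r) / b   ≡⟨ +-distrib-/ (q * b) r (subst (_< b) (sym remainders) r<b) ⟩
    q * b / b + r / b ≡⟨ cong₂ _+_ (m*n/n≡m q b) (m<n⇒m/n≡0 r<b) ⟩
    q + 0             ≡⟨ +-identityʳ q ⟩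
    q                 ∎
    where open ≡-Reasoning
          remainders : q * b % b + r % b ≡ r
          remainders = cong₂ _+_ (m*n%n≡0 q b) (m<n⇒m%n≡m r<b)

  digitSqSum-append : ∀ q {r} → r < b → digitSqSum b (q * b + r) ≡ r * r + digitSqSum b q
  digitSqSum-append q {r} r<b = trans (digitSqSum-step (q * b + r))
    (cong₂ (λ d q′ → d * d + digitSqSum b q′) (%-digit q r<b) (/-digit q r<b))

  digitSqSum-digit : ∀ {a} → a < b → digitSqSum b a ≡ a * a
  digitSqSum-digit {a} a<b = trans (digitSqSum-append 0 a<b) (+-identityʳ (a * a))

  digitSqSum-twoDigits : ∀ {q r} → q < b → r < b → digitSqSum b (q * b + r) ≡ r * r + q * q
  digitSqSum-twoDigits {q} q<b r<b = trans (digitSqSum-append q r<b) (cong (_ +_) (digitSqSum-digit q<b))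

  divMod-decomposition : ∀ a → a ≡ a / b * b + a % b
  divMod-decomposition a = trans (m≡m%n+[m/n]*n a b) (+-comm (a % b) _)

  digitSqSum-bound : ∀ q → b ≤ q → digitSqSum b q + b * b ≤ q * b + 1
  digitSqSum-bound = <-rec _ step
    where
    step : ∀ q → (∀ {p} → p < q → b ≤ p → digitSqSum b p + b * b ≤ p * b + 1) →
           b ≤ q → digitSqSum b q + b * b ≤ q * b + 1
    step q rec b≤q = begin
      digitSqSum b q + b * b               ≡⟨ cong (λ x → digitSqSum b x + b * b) q≡ ⟩
      digitSqSum b (q′ * b + r′) + b * b   ≡⟨ cong (_+ b * b) (digitSqSum-append q′ r′<b) ⟩
      r′ * r′ + digitSqSum b q′ + b * b    ≡⟨ +-assoc (r′ * r′) _ _ ⟩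
      r′ * r′ + (digitSqSum b q′ + b * b)  ≤⟨ +-mono-≤ (*-monoʳ-≤ r′ (<⇒≤ r′<b)) leading ⟩
      r′ * b + (q′ * b * b + 1)            ≡⟨ regroup r′ q′ b ⟩
      (q′ * b + r′) * b + 1                ≡⟨ cong (λ x → x * b + 1) q≡ ⟨
      q * b + 1                            ∎
      where
      open ≤-Reasoning
      q′ = q / b
      r′ = q % b
      r′<b = m%n<n q b
      q≡ = divMod-decomposition q
      regroup : ∀ r q b → r * b + (q * b * b + 1) ≡ (q * b + r) * b + 1
      regroup = solve-∀
      leading : digitSqSum b q′ + b * b ≤ q′ * b * b + 1
      leading with q′ <? b
      ... | yes q′<b = begin
        digitSqSum b q′ + b * b  ≡⟨ cong (_+ b * b) (digitSqSum-digit q′<b) ⟩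
        q′ * q′ + b * b          ≤⟨ m*m+n*n≤m*[n*n]+1 (m≥n⇒m/n>0 b≤q) q′<b ⟩
        q′ * (b * b) + 1         ≡⟨ cong (_+ 1) (*-assoc q′ b b) ⟨
        q′ * b * b + 1           ∎
      ... | no q′≮b = ≤-trans (rec q′<q (≮⇒≥ q′≮b)) (+-monoˡ-≤ 1 (m≤m*n (q′ * b) b))
        where q′<q = m/n<m q b {{>-nonZero (<-≤-trans (<-trans z<s 1<b) b≤q)}} 1<b

  -- With a = q b + r and q ≥ b, digitSqSum-bound gives S(a) + b² ≤ c + r² + q b + 1, and
  -- c + 4 ≤ 3b together with r < b pushes this below q b + r + b².
  S<id : ∀ {c a} → c + 4 ≤ 3 * b → b * b ≤ a → S c b a < a
  S<id {c} {a} c+4≤3b b*b≤a = +-cancelʳ-≤ (4 + b * b) _ _ (begin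
    suc (c + digitSqSum b a) + (4 + b * b)         ≡⟨ cong (λ x → suc (c + digitSqSum b x) + (4 + b * b)) a≡ ⟩
    suc (c + digitSqSum b (q * b + r)) + (4 + b * b) ≡⟨ cong (λ x → suc (c + x) + (4 + b * b)) (digitSqSum-append q r<b) ⟩
    suc (c + (r * r + digitSqSum b q)) + (4 + b * b) ≡⟨ regroup₁ c (r * r) (digitSqSum b q) (b * b) ⟩
    (c + 4) + (r * r + 1) + (digitSqSum b q + b * b) ≤⟨ +-mono-≤ (+-monoˡ-≤ (r * r + 1) c+4≤3b) (digitSqSum-bound q b≤q) ⟩
    3 * b + (r * r + 1) + (q * b + 1)              ≡⟨ regroup₂ (3 * b) (r * r) (q * b) ⟩
    (3 * b + r * r) + (q * b + 2)                  ≤⟨ +-monoˡ-≤ (q * b + 2) (3*n+m*m≤n*n+m+2 r<b) ⟩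
    (b * b + r + 2) + (q * b + 2)                  ≡⟨ regroup₃ (b * b) r (q * b) ⟩
    (q * b + r) + (4 + b * b)                      ≡⟨ cong (_+ (4 + b * b)) a≡ ⟨
    a + (4 + b * b)                                ∎)
    where
    open ≤-Reasoning
    q = a / b
    r = a % b
    r<b = m%n<n a b
    a≡ = divMod-decomposition a
    b≤q : b ≤ q
    b≤q = subst (_≤ q) (m*n/n≡m b b) (/-monoˡ-≤ b b*b≤a)
    regroup₁ : ∀ c x y z → suc (c + (x + y)) + (4 + z) ≡ (c + 4) + (x + 1) + (y + z)
    regroup₁ = solve-∀
    regroup₂ : ∀ t x y → t + (x + 1) + (y + 1) ≡ (t + x) + (y + 2)
    regroup₂ = solve-∀
    regroup₃ : ∀ B r y → (B + r + 2) + (y + 2) ≡ (y + r) + (4 + B)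
    regroup₃ = solve-∀

  fixedPoint<b*b : ∀ {c a} → c + 4 ≤ 3 * b → IsFixedPoint c b a → a < b * b
  fixedPoint<b*b {c} {a} c+4≤3b (_ , Sa≡a) with a <? b * b
  ... | yes a<b*b = a<b*b
  ... | no  a≮b*b = contradiction Sa≡a (<⇒≢ (S<id c+4≤3b (≮⇒≥ a≮b*b)))

  S-twoDigits : ∀ c {a₁ a₀} → a₁ < b → a₀ < b → S c b (a₁ * b + a₀) ≡ c + (a₀ * a₀ + a₁ * a₁)
  S-twoDigits c a₁<b a₀<b = cong (c +_) (digitSqSum-twoDigits a₁<b a₀<b)

-- Counting fixed points and lattice points

module Count {b c : ℕ} .{{_ : NonZero b}} (1<b : 1 < b) (0<c : 0 < c) where
  open Digits 1<b

  onCircle? : ∀ u v → Dec (OnCircle c b u v)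
  onCircle? u v = 4 * c + u * u + v * v ≟ b * b + 1

  circle : ℕ → ℕ → ℕ
  circle u v = 𝟙 (onCircle? u v)

  circle-sym : ∀ u v → circle u v ≡ circle v u
  circle-sym u v = 𝟙-⇔ (mk⇔ (trans (swap u v)) (trans (swap v u))) (onCircle? u v) (onCircle? v u)
    where swap : ∀ u v → 4 * c + v * v + u * u ≡ 4 * c + u * u + v * v
          swap u v = trans (+-assoc (4 * c) _ _) (trans (cong (4 * c +_) (+-comm (v * v) (u * u))) (sym (+-assoc (4 * c) _ _)))

  m : ℤ
  m = ℤ.+ (b * b) ℤ.- ℤ.+ (4 * c) ℤ.+ ℤ.+ 1

  k : ℕ
  k = ℤ.∣ m ∣

  sumOfSquares≡m⇔onCircle : ∀ u v → (ℤ.+ (u * u + v * v) ≡ m) ⇔ OnCircle c b u v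
  sumOfSquares≡m⇔onCircle u v = mk⇔
    (λ eq → trans (+-assoc (4 * c) _ _) (Equivalence.to ([+u]≡[+p]-[+q]+1⇔q+u≡p+1 (b * b) (4 * c) _) eq))
    (λ eq → Equivalence.from ([+u]≡[+p]-[+q]+1⇔q+u≡p+1 (b * b) (4 * c) _) (trans (sym (+-assoc (4 * c) _ _)) eq))

  onCircle⇒≤k : ∀ {u v} → OnCircle c b u v → u ≤ k
  onCircle⇒≤k {u} {v} eq = begin
    u                                   ≤⟨ n≤n*n u ⟩
    u * u                               ≤⟨ m≤m+n (u * u) (v * v) ⟩
    u * u + v * v                       ≡⟨ cong ℤ.∣_∣ (Equivalence.from (sumOfSquares≡m⇔onCircle u v) eq) ⟩
    k                                   ∎
    where
    open ≤-Reasoning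
    n≤n*n : ∀ n → n ≤ n * n
    n≤n*n zero    = z≤n
    n≤n*n (suc n) = m≤m*n (suc n) (suc n)

  onCircle⇒<b : ∀ {u v} → OnCircle c b u v → u < b
  onCircle⇒<b {u} {v} eq with u <? b
  ... | yes u<b = u<b
  ... | no  u≮b = contradiction (+-cancelˡ-≤ (b * b) 4 1 (begin
    b * b + 4             ≤⟨ +-mono-≤ (*-mono-≤ (≮⇒≥ u≮b) (≮⇒≥ u≮b)) (*-monoʳ-≤ 4 0<c) ⟩
    u * u + 4 * c         ≤⟨ m≤m+n _ (v * v) ⟩
    u * u + 4 * c + v * v ≡⟨ cong (_+ v * v) (+-comm (u * u) (4 * c)) ⟩
    4 * c + u * u + v * v ≡⟨ eq ⟩
    b * b + 1             ∎)) (λ { (s≤s ()) })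
    where open ≤-Reasoning

  circle-vanishes : ∀ {u} v → b ≤ u ⊎ k < u → circle u v ≡ 0
  circle-vanishes {u} v (inj₁ b≤u) = 𝟙-¬ (λ eq → <⇒≱ (onCircle⇒<b {u} {v} eq) b≤u) (onCircle? u v)
  circle-vanishes {u} v (inj₂ k<u) = 𝟙-¬ (λ eq → <⇒≱ k<u (onCircle⇒≤k {u} {v} eq)) (onCircle? u v)

  circle-vanishesʳ : ∀ u {v} → b ≤ v ⊎ k < v → circle u v ≡ 0
  circle-vanishesʳ u {v} bound = trans (circle-sym u v) (circle-vanishes u bound)

  circle-parity : ∀ u v → ¬ (u % 2 + v % 2 ≡ b % 2 + 1) → circle u v ≡ 0
  circle-parity u v wrong = 𝟙-¬ (λ eq → wrong (onCircle-parity {c} {b} {u} {v} eq)) (onCircle? u v)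

  0<b : 0 < b
  0<b = <-trans z<s 1<b

  twoDigitFixed⇔onCircle : ∀ {a₁ a₀} → a₁ < b → a₀ < b →
    (S c b (a₁ * b + a₀) ≡ a₁ * b + a₀) ⇔ OnCircle c b ∣ 2 * a₁ - b ∣ ∣ 2 * a₀ - 1 ∣
  twoDigitFixed⇔onCircle {a₁} {a₀} a₁<b a₀<b = mk⇔
    (λ fixed → Equivalence.to equation (trans (sym (S-twoDigits c a₁<b a₀<b)) fixed))
    (λ onCircle → trans (S-twoDigits c a₁<b a₀<b) (Equivalence.from equation onCircle))
    where equation = digitEquation⇔onCircle c b a₁ a₀

  fixed⇒positive : ∀ {a} → S c b a ≡ a → 0 < a
  fixed⇒positive fixed = subst (0 <_) fixed (≤-trans 0<c (m≤m+n c _))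

  fixedPoint⇔onCircle : ∀ {a₁ a₀} → a₁ < b → a₀ < b →
    IsFixedPoint c b (a₁ * b + a₀) ⇔ OnCircle c b ∣ 2 * a₁ - b ∣ ∣ 2 * a₀ - 1 ∣
  fixedPoint⇔onCircle a₁<b a₀<b = mk⇔ (Equivalence.to equation ∘ proj₂)
    (λ onCircle → let fixed = Equivalence.from equation onCircle in fixed⇒positive fixed , fixed)
    where equation = twoDigitFixed⇔onCircle a₁<b a₀<b

  multipleFixed⇔onCircle : ∀ {u} → u < b → (S c b (u * b) ≡ u * b) ⇔ OnCircle c b ∣ 2 * u - b ∣ 1
  multipleFixed⇔onCircle {u} u<b =
    subst (λ a → (S c b a ≡ a) ⇔ OnCircle c b ∣ 2 * u - b ∣ 1) (+-identityʳ (u * b)) (twoDigitFixed⇔onCircle u<b 0<b)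

  isFixedPoint? : ∀ a → Dec (IsFixedPoint c b a)
  isFixedPoint? a = (0 <? a) ×-dec (S c b a ≟ a)

  fixedPoints : List ℕ
  fixedPoints = filter isFixedPoint? (upTo (b * b))

  length-fixedPoints≡sum-circle : length fixedPoints ≡ ∑[ a₁ < b ] ∑[ a₀ < b ] circle ∣ 2 * a₁ - b ∣ ∣ 2 * a₀ - 1 ∣
  length-fixedPoints≡sum-circle = begin
    length fixedPoints                                        ≡⟨ length-filter-applyUpTo isFixedPoint? (b * b) (λ a → a) ⟩
    ∑[ a < b * b ] 𝟙 (isFixedPoint? a)                        ≡⟨ sum-blocks b b _ ⟩
    ∑[ a₁ < b ] ∑[ a₀ < b ] 𝟙 (isFixedPoint? (a₁ * b + a₀))   ≡⟨ sum-cong b (λ a₁ a₁<b → sum-cong b (λ a₀ → indicator a₁<b)) ⟩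
    ∑[ a₁ < b ] ∑[ a₀ < b ] circle ∣ 2 * a₁ - b ∣ ∣ 2 * a₀ - 1 ∣ ∎
    where
    open ≡-Reasoning
    indicator : ∀ {a₁ a₀} → a₁ < b → a₀ < b → 𝟙 (isFixedPoint? (a₁ * b + a₀)) ≡ circle ∣ 2 * a₁ - b ∣ ∣ 2 * a₀ - 1 ∣
    indicator {a₁} {a₀} a₁<b a₀<b =
      𝟙-⇔ (fixedPoint⇔onCircle a₁<b a₀<b) (isFixedPoint? (a₁ * b + a₀)) (onCircle? ∣ 2 * a₁ - b ∣ ∣ 2 * a₀ - 1 ∣)

  F1card≡sum-circle : F1card c b ≡ ∑[ u < b ∸ 1 ] circle ∣ 2 * suc u - b ∣ 1
  F1card≡sum-circle = begin
    F1card c b                                               ≡⟨ cong (length ∘ filter multiple?) (map-upTo suc (b ∸ 1)) ⟩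
    length (filter multiple? (applyUpTo suc (b ∸ 1)))        ≡⟨ length-filter-applyUpTo multiple? (b ∸ 1) suc ⟩
    ∑[ u < b ∸ 1 ] 𝟙 (multiple? (suc u))                     ≡⟨ sum-cong (b ∸ 1) (λ u → indicator ∘ m<n∸1⇒1+m<n) ⟩
    ∑[ u < b ∸ 1 ] circle ∣ 2 * suc u - b ∣ 1                ∎
    where
    open ≡-Reasoning
    multiple? = λ u → S c b (u * b) ≟ u * b
    m<n∸1⇒1+m<n : ∀ {m n} → m < n ∸ 1 → suc m < n
    m<n∸1⇒1+m<n {n = suc n} m<n-1 = s≤s m<n-1
    indicator : ∀ {u} → u < b → 𝟙 (multiple? u) ≡ circle ∣ 2 * u - b ∣ 1
    indicator {u} u<b = 𝟙-⇔ (multipleFixed⇔onCircle u<b) (multiple? u) (onCircle? ∣ 2 * u - b ∣ 1)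

  fixedPoints-unique : Unique fixedPoints
  fixedPoints-unique = filter⁺ isFixedPoint? (upTo⁺ (b * b))

  ∈-fixedPoints⇔ : c + 4 ≤ 3 * b → ∀ a → a ∈ fixedPoints ⇔ IsFixedPoint c b a
  ∈-fixedPoints⇔ c+4≤3b a = mk⇔ (proj₂ ∘ ∈-filter⁻ isFixedPoint? {xs = upTo (b * b)})
    (λ fixedPoint → ∈-filter⁺ isFixedPoint? (∈-upTo⁺ (fixedPoint<b*b c+4≤3b fixedPoint)) fixedPoint)

  M : ℕ
  M = suc (k + b)

  b≤M : b ≤ M
  b≤M = m≤n⇒m≤1+n (m≤n+m b k)

  oddColumn : ℕ → ℕ
  oddColumn u = ∑[ j < M ] circle u (suc (2 * j))

  oddColumn-vanishes : ∀ {u} → b ≤ u → oddColumn u ≡ 0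
  oddColumn-vanishes {u} b≤u = sum-zero M {λ j → circle u (suc (2 * j))} (λ j _ → circle-vanishes (suc (2 * j)) (inj₁ b≤u))

  length-fixedPoints≡F1card+sum-oddColumn : length fixedPoints ≡ F1card c b + ∑[ a₁ < b ] oddColumn ∣ 2 * a₁ - b ∣
  length-fixedPoints≡F1card+sum-oddColumn = begin
    length fixedPoints
      ≡⟨ length-fixedPoints≡sum-circle ⟩
    ∑[ a₁ < b ] ∑[ a₀ < b ] circle ∣ 2 * a₁ - b ∣ ∣ 2 * a₀ - 1 ∣
      ≡⟨ sum-cong b (λ a₁ _ → split-units ∣ 2 * a₁ - b ∣) ⟩
    ∑[ a₁ < b ] (circle ∣ 2 * a₁ - b ∣ 1 + oddColumn ∣ 2 * a₁ - b ∣)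
      ≡⟨ sum-+ b _ _ ⟩
    ∑[ a₁ < b ] circle ∣ 2 * a₁ - b ∣ 1 + ∑[ a₁ < b ] oddColumn ∣ 2 * a₁ - b ∣
      ≡⟨ cong (_+ ∑[ a₁ < b ] oddColumn ∣ 2 * a₁ - b ∣) (sum-head 0<b) ⟩
    circle b 1 + ∑[ u < b ∸ 1 ] circle ∣ 2 * suc u - b ∣ 1 + ∑[ a₁ < b ] oddColumn ∣ 2 * a₁ - b ∣
      ≡⟨ cong₂ (λ x y → x + y + ∑[ a₁ < b ] oddColumn ∣ 2 * a₁ - b ∣) (circle-vanishes 1 (inj₁ ≤-refl)) (sym F1card≡sum-circle) ⟩
    F1card c b + ∑[ a₁ < b ] oddColumn ∣ 2 * a₁ - b ∣
      ∎
    where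
    open ≡-Reasoning
    sum-head : ∀ {n} {f : ℕ → ℕ} → 0 < n → sumBelow n f ≡ f 0 + ∑[ i < n ∸ 1 ] f (suc i)
    sum-head {suc n} _ = refl
    ∣2*[1+j]-1∣ : ∀ j → ∣ 2 * suc j - 1 ∣ ≡ suc (2 * j)
    ∣2*[1+j]-1∣ j = trans (cong ∣_- 1 ∣ (identity j)) (∣m+n-m∣≡n 1 (suc (2 * j)))
      where identity : ∀ j → 2 * suc j ≡ 1 + suc (2 * j)
            identity = solve-∀
    split-units : ∀ u → ∑[ a₀ < b ] circle u ∣ 2 * a₀ - 1 ∣ ≡ circle u 1 + oddColumn u
    split-units u = trans (sum-head 0<b) (cong (circle u 1 +_) (begin
      ∑[ j < b ∸ 1 ] circle u ∣ 2 * suc j - 1 ∣ ≡⟨ sum-cong (b ∸ 1) (λ j _ → cong (circle u) (∣2*[1+j]-1∣ j)) ⟩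
      ∑[ j < b ∸ 1 ] circle u (suc (2 * j))     ≡⟨ sum-truncate (λ j → circle u (suc (2 * j))) (≤-trans (m∸n≤m b 1) b≤M)
                                                     (λ j b-1≤j → circle-vanishesʳ u (inj₁ (odd-large b-1≤j))) ⟨
      oddColumn u                                ∎))
      where odd-large : ∀ {j} → b ∸ 1 ≤ j → b ≤ suc (2 * j)
            odd-large {j} b-1≤j = ≤-trans (m≤n+m∸n b 1) (s≤s (≤-trans b-1≤j (m≤m+n j (j + 0))))

  weighted : ℕ → ℕ → ℕ
  weighted u v = weight u * (weight v * circle u v)

  weighted-vanishes : ∀ u v → circle u v ≡ 0 → weighted u v ≡ 0
  weighted-vanishes u v eq = trans (cong (λ x → weight u * (weight v * x)) eq)
                                   (trans (cong (weight u *_) (*-zeroʳ (weight v))) (*-zeroʳ (weight u)))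

  i*i+j*j≡m⇔onCircle : ∀ i j → (i ℤ.* i ℤ.+ j ℤ.* j ≡ m) ⇔ OnCircle c b ℤ.∣ i ∣ ℤ.∣ j ∣
  i*i+j*j≡m⇔onCircle i j = subst (λ z → (z ≡ m) ⇔ OnCircle c b ℤ.∣ i ∣ ℤ.∣ j ∣) (sym squares)
                                 (sumOfSquares≡m⇔onCircle ℤ.∣ i ∣ ℤ.∣ j ∣)
    where squares : i ℤ.* i ℤ.+ j ℤ.* j ≡ ℤ.+ (ℤ.∣ i ∣ * ℤ.∣ i ∣ + ℤ.∣ j ∣ * ℤ.∣ j ∣)
          squares = trans (cong₂ ℤ._+_ (i*i≡+∣i∣*∣i∣ i) (i*i≡+∣i∣*∣i∣ j))
                          (sym (ℤ.pos-+ (ℤ.∣ i ∣ * ℤ.∣ i ∣) (ℤ.∣ j ∣ * ℤ.∣ j ∣)))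

  r₂≡sum-circle : r₂ m ≡ ∑[ i < suc (k + k) ] ∑[ j < suc (k + k) ] circle ∣ i - k ∣ ∣ j - k ∣
  r₂≡sum-circle = begin
    r₂ m
      ≡⟨ cong (λ xs → length (filter sumOfSquares≡m? (cartesianProduct xs xs))) (map-upTo shift (suc (k + k))) ⟩
    length (filter sumOfSquares≡m? (cartesianProduct (applyUpTo shift (suc (k + k))) (applyUpTo shift (suc (k + k)))))
      ≡⟨ length-filter-cartesianProduct sumOfSquares≡m? (suc (k + k)) (suc (k + k)) shift shift ⟩
    ∑[ i < suc (k + k) ] ∑[ j < suc (k + k) ] 𝟙 (sumOfSquares≡m? (shift i , shift j))
      ≡⟨ sum-cong (suc (k + k)) (λ i _ → sum-cong (suc (k + k)) (λ j _ → indicator i j)) ⟩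
    ∑[ i < suc (k + k) ] ∑[ j < suc (k + k) ] circle ∣ i - k ∣ ∣ j - k ∣
      ∎
    where
    open ≡-Reasoning
    shift : ℕ → ℤ
    shift i = ℤ.+ i ℤ.- ℤ.+ k
    sumOfSquares≡m? : (p : ℤ × ℤ) → Dec (proj₁ p ℤ.* proj₁ p ℤ.+ proj₂ p ℤ.* proj₂ p ≡ m)
    sumOfSquares≡m? (x , y) = x ℤ.* x ℤ.+ y ℤ.* y ℤ.≟ m
    indicator : ∀ i j → 𝟙 (sumOfSquares≡m? (shift i , shift j)) ≡ circle ∣ i - k ∣ ∣ j - k ∣
    indicator i j = trans (𝟙-⇔ (i*i+j*j≡m⇔onCircle (shift i) (shift j))
                               (sumOfSquares≡m? (shift i , shift j)) (onCircle? ℤ.∣ shift i ∣ ℤ.∣ shift j ∣))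
                          (cong₂ circle (∣+m-+n∣≡∣m-n∣ i k) (∣+m-+n∣≡∣m-n∣ j k))

  r₂≡weightedSum : r₂ m ≡ ∑[ u < M + M ] ∑[ v < M + M ] weighted u v
  r₂≡weightedSum = begin
    r₂ m
      ≡⟨ r₂≡sum-circle ⟩
    ∑[ i < suc (k + k) ] ∑[ j < suc (k + k) ] circle ∣ i - k ∣ ∣ j - k ∣
      ≡⟨ sum-cong (suc (k + k)) (λ i _ → sum-fold k (circle ∣ i - k ∣)) ⟩
    ∑[ i < suc (k + k) ] ∑[ v < suc k ] (weight v * circle ∣ i - k ∣ v)
      ≡⟨ sum-fold k (λ u → ∑[ v < suc k ] (weight v * circle u v)) ⟩
    ∑[ u < suc k ] (weight u * ∑[ v < suc k ] (weight v * circle u v))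
      ≡⟨ sum-cong (suc k) (λ u _ → *-distribˡ-sum (suc k) (weight u) (λ v → weight v * circle u v)) ⟨
    ∑[ u < suc k ] ∑[ v < suc k ] weighted u v
      ≡⟨ sum²-truncate weighted k<M+M (λ u v k<u → weighted-vanishes u v (circle-vanishes v (inj₂ k<u)))
                                      (λ u v k<v → weighted-vanishes u v (circle-vanishesʳ u (inj₂ k<v))) ⟨
    ∑[ u < M + M ] ∑[ v < M + M ] weighted u v
      ∎
    where
    open ≡-Reasoning
    k<M+M : suc k ≤ M + M
    k<M+M = ≤-trans (s≤s (m≤m+n k b)) (m≤m+n M M)

  sum²-weighted-vanishes : ∀ (row col : ℕ → ℕ) → (∀ i j → circle (row i) (col j) ≡ 0) →
                           ∑[ i < M ] ∑[ j < M ] weighted (row i) (col j) ≡ 0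
  sum²-weighted-vanishes row col eq = sum-zero M (λ i _ → sum-zero M (λ j _ → weighted-vanishes (row i) (col j) (eq i j)))

  weighted-sym : ∀ u v → weighted u v ≡ weighted v u
  weighted-sym u v = trans (cong (λ x → weight u * (weight v * x)) (circle-sym u v)) (*-CS.x∙yz≈y∙xz (weight u) (weight v) _)

  module OddBase (b%2≡1 : b % 2 ≡ 1) where
    open ≡-Reasoning

    t : ℕ
    t = b / 2

    b≡1+2t : b ≡ suc (2 * t)
    b≡1+2t = trans (m≡m%n+[m/n]*n b 2) (cong₂ _+_ b%2≡1 (*-comm t 2))

    circle-evenˡ≡0 : ∀ i v → circle (2 * i) v ≡ 0
    circle-evenˡ≡0 i v = circle-parity (2 * i) v (λ eq → <⇒≢ (m%n<n v 2) (begin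
      v % 2                  ≡⟨ cong (_+ v % 2) ([2*n]%2≡0 i) ⟨
      2 * i % 2 + v % 2      ≡⟨ eq ⟩
      b % 2 + 1              ≡⟨ cong (_+ 1) b%2≡1 ⟩
      2                      ∎))

    circle-evenʳ≡0 : ∀ u j → circle u (2 * j) ≡ 0
    circle-evenʳ≡0 u j = trans (circle-sym u (2 * j)) (circle-evenˡ≡0 j u)

    T : ℕ
    T = ∑[ i < M ] oddColumn (suc (2 * i))

    sum-oddColumn≡2T : ∑[ a₁ < b ] oddColumn ∣ 2 * a₁ - b ∣ ≡ 2 * T
    sum-oddColumn≡2T = begin
      ∑[ a₁ < b ] oddColumn ∣ 2 * a₁ - b ∣
        ≡⟨ subst (λ B → ∑[ a < B ] oddColumn ∣ 2 * a - B ∣ ≡ oddColumn B + 2 * ∑[ i < t ] oddColumn (suc (2 * i)))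
                 (sym b≡1+2t) (sum-fold-odd t oddColumn) ⟩
      oddColumn b + 2 * ∑[ i < t ] oddColumn (suc (2 * i))
        ≡⟨ cong₂ (λ x y → x + 2 * y) (oddColumn-vanishes ≤-refl)
                 (sym (sum-truncate (λ i → oddColumn (suc (2 * i))) t≤M (λ i → oddColumn-vanishes ∘ b≤1+2i))) ⟩
      2 * T ∎
      where t≤M : t ≤ M
            t≤M = ≤-trans (m/n≤m b 2) b≤M
            b≤1+2i : ∀ {i} → t ≤ i → b ≤ suc (2 * i)
            b≤1+2i {i} t≤i = subst (_≤ suc (2 * i)) (sym b≡1+2t) (s≤s (*-monoʳ-≤ 2 t≤i))

    r₂≡4T : r₂ m ≡ 4 * T
    r₂≡4T = begin
      r₂ m
        ≡⟨ r₂≡weightedSum ⟩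
      ∑[ u < M + M ] ∑[ v < M + M ] weighted u v
        ≡⟨ sum²-evens-odds M weighted ⟩
      (∑[ i < M ] ∑[ j < M ] weighted (2 * i) (2 * j) + ∑[ i < M ] ∑[ j < M ] weighted (2 * i) (suc (2 * j)))
      + (∑[ i < M ] ∑[ j < M ] weighted (suc (2 * i)) (2 * j) + ∑[ i < M ] ∑[ j < M ] weighted (suc (2 * i)) (suc (2 * j)))
        ≡⟨ cong₂ _+_ (cong₂ _+_ (sum²-weighted-vanishes (2 *_) (2 *_) (λ i j → circle-evenˡ≡0 i (2 * j)))
                                 (sum²-weighted-vanishes (2 *_) (λ j → suc (2 * j)) (λ i j → circle-evenˡ≡0 i (suc (2 * j)))))
                      (cong (_+ ∑[ i < M ] ∑[ j < M ] weighted (suc (2 * i)) (suc (2 * j)))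
                            (sum²-weighted-vanishes (λ i → suc (2 * i)) (2 *_) (λ i → circle-evenʳ≡0 (suc (2 * i))))) ⟩
      ∑[ i < M ] ∑[ j < M ] (2 * (2 * circle (suc (2 * i)) (suc (2 * j))))
        ≡⟨ sum-cong M (λ i _ → trans (sum-cong M (λ j _ → sym (*-assoc 2 2 (circle (suc (2 * i)) (suc (2 * j))))))
                                      (*-distribˡ-sum M 4 (λ j → circle (suc (2 * i)) (suc (2 * j))))) ⟩
      ∑[ i < M ] (4 * oddColumn (suc (2 * i)))
        ≡⟨ *-distribˡ-sum M 4 (λ i → oddColumn (suc (2 * i))) ⟩
      4 * T ∎

    2*length-fixedPoints : 2 * length fixedPoints ≡ r₂ m + 2 * F1card c b
    2*length-fixedPoints = begin
      2 * length fixedPoints   ≡⟨ cong (2 *_) (trans length-fixedPoints≡F1card+sum-oddColumn (cong (F1card c b +_) sum-oddColumn≡2T)) ⟩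
      2 * (F1card c b + 2 * T) ≡⟨ regroup (F1card c b) T ⟩
      4 * T + 2 * F1card c b   ≡⟨ cong (_+ 2 * F1card c b) r₂≡4T ⟨
      r₂ m + 2 * F1card c b    ∎
      where regroup : ∀ F T → 2 * (F + 2 * T) ≡ 4 * T + 2 * F
            regroup = solve-∀

  module EvenBase (b%2≡0 : b % 2 ≡ 0) where
    open ≡-Reasoning

    t : ℕ
    t = b / 2

    b≡2t : b ≡ 2 * t
    b≡2t = trans (m≡m%n+[m/n]*n b 2) (cong₂ _+_ b%2≡0 (*-comm t 2))

    circle-even-even≡0 : ∀ i j → circle (2 * i) (2 * j) ≡ 0
    circle-even-even≡0 i j = circle-parity (2 * i) (2 * j) (λ eq → 0≢1+n (begin
      0                      ≡⟨ cong₂ _+_ ([2*n]%2≡0 i) ([2*n]%2≡0 j) ⟨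
      2 * i % 2 + 2 * j % 2  ≡⟨ eq ⟩
      b % 2 + 1              ≡⟨ cong (_+ 1) b%2≡0 ⟩
      1                      ∎))

    circle-odd-odd≡0 : ∀ i j → circle (suc (2 * i)) (suc (2 * j)) ≡ 0
    circle-odd-odd≡0 i j = circle-parity (suc (2 * i)) (suc (2 * j)) (λ eq → 1+n≢0 (suc-injective (begin
      2                                  ≡⟨ cong₂ _+_ ([1+2*n]%2≡1 i) ([1+2*n]%2≡1 j) ⟨
      suc (2 * i) % 2 + suc (2 * j) % 2  ≡⟨ eq ⟩
      b % 2 + 1                          ≡⟨ cong (_+ 1) b%2≡0 ⟩
      1                                  ∎)))

    V : ℕ
    V = ∑[ i < M ] (weight i * oddColumn (2 * i))

    sum-oddColumn≡V : ∑[ a₁ < b ] oddColumn ∣ 2 * a₁ - b ∣ ≡ V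
    sum-oddColumn≡V = begin
      ∑[ a₁ < b ] oddColumn ∣ 2 * a₁ - b ∣
        ≡⟨ subst (λ B → ∑[ a < B ] oddColumn ∣ 2 * a - B ∣ ≡ ∑[ a < t + t ] oddColumn ∣ 2 * a - 2 * t ∣)
                 (sym b≡2t) (cong (λ n → sumBelow n (λ a → oddColumn ∣ 2 * a - 2 * t ∣)) (cong (t +_) (+-identityʳ t))) ⟩
      ∑[ a < t + t ] oddColumn ∣ 2 * a - 2 * t ∣
        ≡⟨ sum-truncate _ (n≤1+n (t + t)) (λ a t+t≤a → oddColumn-vanishes (b≤∣2a-2t∣ t+t≤a)) ⟨
      ∑[ a < suc (t + t) ] oddColumn ∣ 2 * a - 2 * t ∣
        ≡⟨ sum-cong (suc (t + t)) (λ a _ → cong oddColumn (*-distribˡ-∣-∣ 2 a t)) ⟨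
      ∑[ a < suc (t + t) ] oddColumn (2 * ∣ a - t ∣)
        ≡⟨ sum-fold t (λ u → oddColumn (2 * u)) ⟩
      ∑[ u < suc t ] (weight u * oddColumn (2 * u))
        ≡⟨ sum-truncate (λ u → weight u * oddColumn (2 * u)) t<M
                        (λ u t<u → trans (cong (weight u *_) (oddColumn-vanishes (b≤2u t<u))) (*-zeroʳ (weight u))) ⟨
      V ∎
      where
      t<M : suc t ≤ M
      t<M = s≤s (≤-trans (m/n≤m b 2) (m≤n+m b k))
      b≤2u : ∀ {u} → t < u → b ≤ 2 * u
      b≤2u {u} t<u = subst (_≤ 2 * u) (sym b≡2t) (*-monoʳ-≤ 2 (<⇒≤ t<u))
      b≤∣2a-2t∣ : ∀ {a} → t + t ≤ a → b ≤ ∣ 2 * a - 2 * t ∣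
      b≤∣2a-2t∣ t+t≤a with e , refl ← m≤n⇒∃[o]m+o≡n t+t≤a =
        subst₂ _≤_ (sym b≡2t) (trans (sym (∣m+n-m∣≡n (2 * t) (2 * t + 2 * e))) (cong ∣_- 2 * t ∣ (identity t e)))
               (m≤m+n (2 * t) (2 * e))
        where identity : ∀ t e → 2 * t + (2 * t + 2 * e) ≡ 2 * (t + t + e)
              identity = solve-∀

    r₂≡4V : r₂ m ≡ 4 * V
    r₂≡4V = begin
      r₂ m
        ≡⟨ r₂≡weightedSum ⟩
      ∑[ u < M + M ] ∑[ v < M + M ] weighted u v
        ≡⟨ sum²-evens-odds M weighted ⟩
      (∑[ i < M ] ∑[ j < M ] weighted (2 * i) (2 * j) + evenOdd)
      + (∑[ i < M ] ∑[ j < M ] weighted (suc (2 * i)) (2 * j) + ∑[ i < M ] ∑[ j < M ] weighted (suc (2 * i)) (suc (2 * j)))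
        ≡⟨ cong₂ _+_ (cong (_+ evenOdd) (sum²-weighted-vanishes (2 *_) (2 *_) circle-even-even≡0))
                     (cong (∑[ i < M ] ∑[ j < M ] weighted (suc (2 * i)) (2 * j) +_)
                           (sum²-weighted-vanishes (λ i → suc (2 * i)) (λ j → suc (2 * j)) circle-odd-odd≡0)) ⟩
      evenOdd + (∑[ i < M ] ∑[ j < M ] weighted (suc (2 * i)) (2 * j) + 0)
        ≡⟨ cong (evenOdd +_) (trans (+-identityʳ _) (trans (sum-comm M M (λ i j → weighted (suc (2 * i)) (2 * j)))
             (sum-cong M (λ j _ → sum-cong M (λ i _ → weighted-sym (suc (2 * i)) (2 * j)))))) ⟩
      evenOdd + evenOdd
        ≡⟨ cong₂ _+_ evenOdd≡2V evenOdd≡2V ⟩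
      2 * V + 2 * V
        ≡⟨ double V ⟩
      4 * V ∎
      where
      evenOdd = ∑[ i < M ] ∑[ j < M ] weighted (2 * i) (suc (2 * j))
      double : ∀ x → 2 * x + 2 * x ≡ 4 * x
      double = solve-∀
      evenOdd-row : ∀ i → ∑[ j < M ] weighted (2 * i) (suc (2 * j)) ≡ 2 * (weight i * oddColumn (2 * i))
      evenOdd-row i = begin
        ∑[ j < M ] (weight (2 * i) * (2 * circle (2 * i) (suc (2 * j))))
          ≡⟨ *-distribˡ-sum M (weight (2 * i)) (λ j → 2 * circle (2 * i) (suc (2 * j))) ⟩
        weight (2 * i) * ∑[ j < M ] (2 * circle (2 * i) (suc (2 * j)))
          ≡⟨ cong₂ _*_ (weight-double i) (*-distribˡ-sum M 2 (λ j → circle (2 * i) (suc (2 * j)))) ⟩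
        weight i * (2 * oddColumn (2 * i))
          ≡⟨ *-CS.x∙yz≈y∙xz (weight i) 2 (oddColumn (2 * i)) ⟩
        2 * (weight i * oddColumn (2 * i)) ∎
      evenOdd≡2V : evenOdd ≡ 2 * V
      evenOdd≡2V = trans (sum-cong M (λ i _ → evenOdd-row i)) (*-distribˡ-sum M 2 (λ i → weight i * oddColumn (2 * i)))

    4*length-fixedPoints : 4 * length fixedPoints ≡ r₂ m + 4 * F1card c b
    4*length-fixedPoints = begin
      4 * length fixedPoints   ≡⟨ cong (4 *_) (trans length-fixedPoints≡F1card+sum-oddColumn (cong (F1card c b +_) sum-oddColumn≡V)) ⟩
      4 * (F1card c b + V)     ≡⟨ *-distribˡ-+ 4 (F1card c b) V ⟩
      4 * F1card c b + 4 * V   ≡⟨ +-comm (4 * F1card c b) (4 * V) ⟩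
      4 * V + 4 * F1card c b   ≡⟨ cong (_+ 4 * F1card c b) r₂≡4V ⟨
      r₂ m + 4 * F1card c b    ∎

open import Data.Integer using (+_)

corollary3p5 : (b c : ℕ) .{{_ : NonZero b}} → 2 ≤ b → 0 < c → c < 3 * b ∸ 3 →
    Σ (List ℕ) (λ fps →
      Unique fps
      × ((a : ℕ) → (a ∈ fps) ⇔ IsFixedPoint c b a)
      × (b % 2 ≡ 1 → 2 * length fps ≡ r₂ ((+ (b * b)) ℤ.- (+ (4 * c)) ℤ.+ (+ 1)) + 2 * F1card c b)
      × (b % 2 ≡ 0 → 4 * length fps ≡ r₂ ((+ (b * b)) ℤ.- (+ (4 * c)) ℤ.+ (+ 1)) + 4 * F1card c b))
corollary3p5 b c 1<b 0<c c<3b∸3 =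
  fixedPoints , fixedPoints-unique , ∈-fixedPoints⇔ c+4≤3b ,
  OddBase.2*length-fixedPoints , EvenBase.4*length-fixedPoints
  where
  open Count 1<b 0<c
  c+4≤3b : c + 4 ≤ 3 * b
  c+4≤3b = subst (_≤ 3 * b) (sym (+-suc c 3)) (m≤o∸n⇒m+n≤o (suc c) (*-monoʳ-≤ 3 (<⇒≤ 1<b)) c<3b∸3)
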